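{- \textsc{Multidimensional-Knapsack} with $n$ items and $M$ dimensions has a static equivalent instance of size $O(Mn^2\log(n))$.
   Context: A \textsc{Multidimensional-Knapsack} instance consists of $n$ items with weight vectors $w^{(i)}\in\mathbb{Z}_{\ge0}^M$ and profits $p_i$, a capacity vector $b\in\mathbb{Z}_{\ge0}^M$ and a target $T$; a solution is a subset $I'$ of items with $\sum_{i\in I'}w^{(i)}_j\le b_j$ for all $j\in[M]$ and $\sum_{i\in I'}p_i\ge T$. A static equivalent instance is an instance of the same problem having exactly the same set of solutions. Size means binary encoding length. -}

module Defs where

open import Data.Nat using (ℕ; zero; suc; _+_; _*_; _≤_)
open import Data.Nat.Logarithm using (⌊log₂_⌋)
open import Data.Fin using (Fin; zero; suc)
open import Data.Bool using (Bool; true; false; if_then_else_)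
open import Data.Product using (_×_)

∑ : (n : ℕ) → (Fin n → ℕ) → ℕ
∑ zero    f = 0
∑ (suc n) f = f zero + ∑ n (λ i → f (suc i))

record MKInstance (n M : ℕ) : Set where
  field
    weight   : Fin n → Fin M → ℕ
    profit   : Fin n → ℕ
    capacity : Fin M → ℕ
    target   : ℕ
open MKInstance public

ItemSet : ℕ → Set
ItemSet n = Fin n → Bool

∑∈ : {n : ℕ} → ItemSet n → (Fin n → ℕ) → ℕ
∑∈ {n} S f = ∑ n (λ i → if S i then f i else 0)

IsSolution : {n M : ℕ} → MKInstance n M → ItemSet n → Set
IsSolution {n} {M} I S =
  ((j : Fin M) → ∑∈ S (λ i → weight I i j) ≤ capacity I j)
  × (target I ≤ ∑∈ S (profit I))

StaticEquivalent : {n M : ℕ} → MKInstance n M → MKInstance n M → Set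
StaticEquivalent {n} I J =
  (S : ItemSet n) → (IsSolution I S → IsSolution J S) × (IsSolution J S → IsSolution I S)

bitLength : ℕ → ℕ
bitLength zero = 1
bitLength (suc k) = suc ⌊log₂ (suc k) ⌋

size : {n M : ℕ} → MKInstance n M → ℕ
size {n} {M} I =
    ∑ n (λ i → ∑ M (λ j → bitLength (weight I i j)))
  + ∑ n (λ i → bitLength (profit I i))
  + ∑ M (λ j → bitLength (capacity I j))
  + bitLength (target I)

module Submission where

open import Data.Nat using (ℕ)
open import Data.Nat.Logarithm using (⌈log₂_⌉)
open import Data.Product using (Σ; _×_)
open import Defs

-- Each constraint is replaced by an equivalent one with small numbers. For a capacity constraint (w, b) on
-- n items, take the polyhedral cone of x = (ε, b′, w′) ∈ ℤ^(n+2) cut out by nonnegativity and, for every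
-- subset S, by b′ − Σ_S w′ ≥ 0 if S fits (w, b) and by Σ_S w′ − b′ − ε ≥ 0 otherwise: every point of it
-- with ε > 0 gives an equivalent constraint (w′, b′), and (1, b, w) is such a point. All rows have entries
-- in {−1, 0, 1}. Pivoting from (1, b, w) adds tight rows until they form a nonsingular (n+1)×(n+1) minor
-- off the ε-column; by Cramer's rule the resulting ray has integer entries bounded by a product of two
-- such minors, hence by (n+2)^(2(n+2)), which has O(n log n) bits. A target constraint T ≤ Σ p is the
-- negation of the capacity constraint Σ p ≤ T − 1.

module IntegerVectors where

  open import Data.Nat as ℕ using (ℕ; zero; suc)
  import Data.Nat.Properties as ℕ
  open import Data.Integer as ℤ using (ℤ; +_; +[1+_]; -[1+_]; -_; _+_; _*_; 0ℤ; 1ℤ; -1ℤ; ∣_∣; _≤_; _<_; +≤+; +<+)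
  import Data.Integer.Properties as ℤ
  open import Data.Integer.Tactic.RingSolver using (solve-∀)
  open import Data.Fin as Fin using (Fin; zero; suc; _≟_; punchIn)
  open import Data.Fin.Properties using (punchInᵢ≢i)
  open import Data.Bool using (Bool; true; false; if_then_else_)
  open import Data.Vec.Functional using (Vector; removeAt)
  open import Function using (_∘_)
  open import Data.Empty using (⊥-elim)
  open import Relation.Nullary using (does)
  open import Relation.Nullary.Decidable using (dec-true; dec-false)
  open import Relation.Binary.PropositionalEquality
  open import Algebra.Properties.Semiring.Sum ℤ.+-*-semiring
    using (sum; sum-syntax; sum-cong-≗; ∑-distrib-+; ∑-comm; sum-remove; sum-replicate-zero; *-distribˡ-sum)
  import Algebra.Properties.CommutativeMonoid.Sum ℕ.+-0-commutativeMonoid as ℕΣ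

  private variable N : ℕ

  *-nonneg : ∀ {a b} → 0ℤ ≤ a → 0ℤ ≤ b → 0ℤ ≤ a * b
  *-nonneg {+ m} {+ n} _ _ = subst (0ℤ ≤_) (ℤ.pos-* m n) (+≤+ ℕ.z≤n)

  *-pos : ∀ {a b} → 0ℤ < a → 0ℤ < b → 0ℤ < a * b
  *-pos {+[1+ m ]} {+[1+ n ]} _        _        = +<+ (ℕ.s≤s ℕ.z≤n)
  *-pos {+ zero}   {_}        (+<+ ()) _
  *-pos {+[1+ m ]} {+ zero}   _        (+<+ ())

  square-pos : ∀ {a} → a ≢ 0ℤ → 0ℤ < a * a
  square-pos {+ zero}    a≢0 = ⊥-elim (a≢0 refl)
  square-pos {+[1+ n ]} _   = +<+ (ℕ.s≤s ℕ.z≤n)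
  square-pos { -[1+ n ]} _  = +<+ (ℕ.s≤s ℕ.z≤n)

  nonneg-cancelˡ : ∀ {c v} → 0ℤ < c → 0ℤ ≤ c * v → 0ℤ ≤ v
  nonneg-cancelˡ {+[1+ m ]} {+ n}      _ _ = +≤+ ℕ.z≤n
  nonneg-cancelˡ {+[1+ m ]} { -[1+ n ]} _ ()
  nonneg-cancelˡ {+ zero}   (+<+ ()) _

  self-negating : ∀ {x} → x ≡ - x → x ≡ 0ℤ
  self-negating {ℤ.+0} _ = refl

  *≡0-cancelˡ : ∀ {i j} → i ≢ 0ℤ → i * j ≡ 0ℤ → j ≡ 0ℤ
  *≡0-cancelˡ {i} {j} i≢0 ij≡0 = ℤ.*-cancelˡ-≡ i j 0ℤ {{ℤ.≢-nonZero i≢0}} (trans ij≡0 (sym (ℤ.*-zeroʳ i)))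

  *≡0-cancelʳ : ∀ {i j} → j ≢ 0ℤ → i * j ≡ 0ℤ → i ≡ 0ℤ
  *≡0-cancelʳ {i} {j} j≢0 ij≡0 = *≡0-cancelˡ j≢0 (trans (ℤ.*-comm j i) ij≡0)

  sum-zero : {f : Vector ℤ N} → (∀ i → f i ≡ 0ℤ) → sum f ≡ 0ℤ
  sum-zero {N} f≗0 = trans (sum-cong-≗ f≗0) (sum-replicate-zero N)

  sum-neg : (f : Vector ℤ N) → sum (λ i → - f i) ≡ - sum f
  sum-neg f = begin
    sum (λ i → - f i)      ≡⟨ sum-cong-≗ (λ i → sym (ℤ.-1*i≡-i (f i))) ⟩
    sum (λ i → -1ℤ * f i)  ≡⟨ sym (*-distribˡ-sum -1ℤ f) ⟩
    -1ℤ * sum f            ≡⟨ ℤ.-1*i≡-i (sum f) ⟩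
    - sum f                ∎
    where open ≡-Reasoning

  sum-supported-at : {f : Vector ℤ N} (m : Fin N) → (∀ i → i ≢ m → f i ≡ 0ℤ) → sum f ≡ f m
  sum-supported-at {suc N} {f} m f≗0 = begin
    sum f                         ≡⟨ sum-remove f ⟩
    f m + sum (removeAt f m)      ≡⟨ cong (λ s → f m + s) (sum-zero (λ j → f≗0 (punchIn m j) (punchInᵢ≢i m j))) ⟩
    f m + 0ℤ                      ≡⟨ ℤ.+-identityʳ (f m) ⟩
    f m                           ∎
    where open ≡-Reasoning

  dot : Vector ℤ N → Vector ℤ N → ℤ
  dot a x = sum (λ i → a i * x i)

  dot-linearʳ : ∀ (a : Vector ℤ N) p x q y →
                dot a (λ i → p * x i + q * y i) ≡ p * dot a x + q * dot a y
  dot-linearʳ {N} a p x q y = begin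
    ∑[ i < N ] (a i * (p * x i + q * y i))                         ≡⟨ sum-cong-≗ (λ i → distrib (a i) p (x i) q (y i)) ⟩
    ∑[ i < N ] (p * (a i * x i) + q * (a i * y i))                 ≡⟨ ∑-distrib-+ (λ i → p * (a i * x i)) (λ i → q * (a i * y i)) ⟩
    ∑[ i < N ] (p * (a i * x i)) + ∑[ i < N ] (q * (a i * y i))    ≡⟨ cong₂ _+_ (*-distribˡ-sum p (λ i → a i * x i))
                                                                               (*-distribˡ-sum q (λ i → a i * y i)) ⟨
    p * dot a x + q * dot a y                                      ∎
    where
    open ≡-Reasoning
    distrib : ∀ a p x q y → a * (p * x + q * y) ≡ p * (a * x) + q * (a * y)
    distrib = solve-∀

  dot-scaleʳ : ∀ (a : Vector ℤ N) c x → dot a (λ i → c * x i) ≡ c * dot a x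
  dot-scaleʳ a c x = trans (sum-cong-≗ (λ i → swap (a i) c (x i))) (sym (*-distribˡ-sum c (λ i → a i * x i)))
    where
    swap : ∀ a c x → a * (c * x) ≡ c * (a * x)
    swap = solve-∀

  dot-congʳ : ∀ (a : Vector ℤ N) {x y} → x ≗ y → dot a x ≡ dot a y
  dot-congʳ a x≗y = sum-cong-≗ (λ i → cong (a i *_) (x≗y i))

  dot-zeroʳ : ∀ (a : Vector ℤ N) {x} → (∀ i → x i ≡ 0ℤ) → dot a x ≡ 0ℤ
  dot-zeroʳ a x≗0 = sum-zero (λ i → trans (cong (a i *_) (x≗0 i)) (ℤ.*-zeroʳ (a i)))

  dot-negˡ : ∀ (a x : Vector ℤ N) → dot (λ i → - a i) x ≡ - dot a x
  dot-negˡ a x = trans (sum-cong-≗ (λ i → sym (ℤ.neg-distribˡ-* (a i) (x i)))) (sum-neg (λ i → a i * x i))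

  dot-antisymmetric : ∀ {T : Fin N → Fin N → ℤ} → (∀ a b → T a b ≡ - T b a) → ∀ x y →
                      dot x (λ a → dot y (T a)) ≡ - dot y (λ a → dot x (T a))
  dot-antisymmetric {N} {T} T-antisym x y = begin
    ∑[ a < N ] (x a * ∑[ b < N ] (y b * T a b))         ≡⟨ sum-cong-≗ (λ a → *-distribˡ-sum (x a) (λ b → y b * T a b)) ⟩
    ∑[ a < N ] (∑[ b < N ] (x a * (y b * T a b)))       ≡⟨ ∑-comm (λ a b → x a * (y b * T a b)) ⟩
    ∑[ b < N ] (∑[ a < N ] (x a * (y b * T a b)))       ≡⟨ sum-cong-≗ (λ b → sum-cong-≗ (λ a → swap-antisym a b)) ⟩
    ∑[ b < N ] (∑[ a < N ] (- (y b * (x a * T b a))))   ≡⟨ sum-cong-≗ (λ b → sum-neg (λ a → y b * (x a * T b a))) ⟩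
    ∑[ b < N ] (- ∑[ a < N ] (y b * (x a * T b a)))     ≡⟨ sum-neg (λ b → ∑[ a < N ] (y b * (x a * T b a))) ⟩
    - ∑[ b < N ] (∑[ a < N ] (y b * (x a * T b a)))     ≡⟨ cong -_ (sum-cong-≗ (λ b → *-distribˡ-sum (y b) (λ a → x a * T b a))) ⟨
    - ∑[ b < N ] (y b * ∑[ a < N ] (x a * T b a))       ∎
    where
    open ≡-Reasoning
    swap-antisym : ∀ a b → x a * (y b * T a b) ≡ - (y b * (x a * T b a))
    swap-antisym a b = trans (cong (λ t → x a * (y b * t)) (T-antisym a b)) (ring (x a) (y b) (T b a))
      where
      ring : ∀ x y t → x * (y * - t) ≡ - (y * (x * t))
      ring = solve-∀

  indicator : Vector Bool N → Vector ℤ N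
  indicator S i = if S i then 1ℤ else 0ℤ

  unit : Fin N → Vector ℤ N
  unit m = indicator (λ i → does (i ≟ m))

  dot-unitˡ : ∀ (m : Fin N) x → dot (unit m) x ≡ x m
  dot-unitˡ m x = begin
    dot (unit m) x    ≡⟨ sum-supported-at m (λ i i≢m → cong (λ b → (if b then 1ℤ else 0ℤ) * x i) (dec-false (i ≟ m) i≢m)) ⟩
    unit m m * x m    ≡⟨ cong (λ b → (if b then 1ℤ else 0ℤ) * x m) (dec-true (m ≟ m) refl) ⟩
    1ℤ * x m          ≡⟨ ℤ.*-identityˡ (x m) ⟩
    x m               ∎
    where open ≡-Reasoning

  ∣sum∣≤ : ∀ {f : Vector ℤ N} B → (∀ i → ∣ f i ∣ ℕ.≤ B) → ∣ sum f ∣ ℕ.≤ N ℕ.* B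
  ∣sum∣≤ {zero}      B f≤B = ℕ.z≤n
  ∣sum∣≤ {suc N} {f} B f≤B = ℕ.≤-trans (ℤ.∣i+j∣≤∣i∣+∣j∣ (f zero) (sum (f ∘ suc)))
                                       (ℕ.+-mono-≤ (f≤B zero) (∣sum∣≤ B (f≤B ∘ suc)))

  SignVector : Vector ℤ N → Set
  SignVector a = ∀ i → ∣ a i ∣ ℕ.≤ 1

  ∣dot∣≤ : ∀ {B} (a x : Vector ℤ N) → SignVector a → (∀ i → ∣ x i ∣ ℕ.≤ B) → ∣ dot a x ∣ ℕ.≤ N ℕ.* B
  ∣dot∣≤ {B = B} a x a-sign x≤B = ∣sum∣≤ B (λ i → begin
    ∣ a i * x i ∣        ≡⟨ ℤ.∣i*j∣≡∣i∣*∣j∣ (a i) (x i) ⟩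
    ∣ a i ∣ ℕ.* ∣ x i ∣  ≤⟨ ℕ.*-mono-≤ (a-sign i) (x≤B i) ⟩
    1 ℕ.* B              ≡⟨ ℕ.*-identityˡ B ⟩
    B                    ∎)
    where open ℕ.≤-Reasoning

  indicator-sign : ∀ (S : Vector Bool N) → SignVector (indicator S)
  indicator-sign S i with S i
  ... | true  = ℕ.≤-refl
  ... | false = ℕ.z≤n

  unit-sign : ∀ (m : Fin N) → SignVector (unit m)
  unit-sign m = indicator-sign (λ i → does (i ≟ m))

module Minors where

  open import Data.Nat as ℕ using (ℕ; zero; suc)
  import Data.Nat.Properties as ℕ
  open import Data.Integer as ℤ using (ℤ; -_; _+_; _-_; _*_; _^_; 0ℤ; 1ℤ; -1ℤ; ∣_∣)
  import Data.Integer.Properties as ℤ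
  open import Data.Integer.Tactic.RingSolver using (solve-∀)
  open import Data.Fin as Fin using (Fin; zero; suc; _≟_; _<?_; punchIn)
  open import Data.Fin.Properties using (<-cmp; <-asym; punchInᵢ≢i)
  open import Data.Bool using (Bool; true; false; if_then_else_; _∧_; _∨_; not)
  open import Data.Bool.Properties using (∧-zeroʳ)
  open import Data.List using (List; []; _∷_; length)
  open import Data.List.Membership.Propositional using (_∈_)
  open import Data.List.Relation.Unary.All using (All; []; _∷_)
  open import Data.List.Relation.Unary.Any using (here; there)
  open import Data.Empty using (⊥-elim)
  open import Data.Vec.Functional using (Vector; removeAt)
  open import Function using (_∘_)
  open import Relation.Binary using (tri<; tri≈; tri>)
  open import Relation.Nullary using (Dec; does; yes; no)
  open import Relation.Nullary.Decidable using (dec-true; dec-false)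
  open import Relation.Binary.PropositionalEquality
  open import Algebra.Properties.Semiring.Sum ℤ.+-*-semiring using (sum-cong-≗)
  import Algebra.Properties.CommutativeMonoid.Sum ℕ.+-0-commutativeMonoid as ℕΣ
  open IntegerVectors

  private variable N : ℕ

  bit : Bool → ℕ
  bit b = if b then 1 else 0

  count : Vector Bool N → ℕ
  count p = ℕΣ.sum (bit ∘ p)

  count-≤ : (p : Vector Bool N) → count p ℕ.≤ N
  count-≤ {zero}  p = ℕ.z≤n
  count-≤ {suc N} p with p zero
  ... | true  = ℕ.s≤s (count-≤ (p ∘ suc))
  ... | false = ℕ.m≤n⇒m≤1+n (count-≤ (p ∘ suc))

  count-none : count {N} (λ _ → false) ≡ 0
  count-none {N} = ℕΣ.sum-replicate-zero N

  count-update : {p q : Vector Bool N} (a : Fin N) → (∀ i → i ≢ a → p i ≡ q i) → p a ≡ false →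
                 count q ≡ bit (q a) ℕ.+ count p
  count-update {suc N} {p} {q} a p≗q pa≡false = begin
    count q                                      ≡⟨ ℕΣ.sum-remove (bit ∘ q) ⟩
    bit (q a) ℕ.+ ℕΣ.sum (removeAt (bit ∘ q) a)  ≡⟨ cong (bit (q a) ℕ.+_) (ℕΣ.sum-cong-≗ agree) ⟩
    bit (q a) ℕ.+ rest                           ≡⟨ cong (λ b → bit (q a) ℕ.+ (bit b ℕ.+ rest)) pa≡false ⟨
    bit (q a) ℕ.+ (bit (p a) ℕ.+ rest)           ≡⟨ cong (bit (q a) ℕ.+_) (ℕΣ.sum-remove (bit ∘ p)) ⟨
    bit (q a) ℕ.+ count p                        ∎
    where
    open ≡-Reasoning
    rest = ℕΣ.sum (removeAt (bit ∘ p) a)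
    agree : removeAt (bit ∘ q) a ≗ removeAt (bit ∘ p) a
    agree j = cong bit (sym (p≗q (punchIn a j) (punchInᵢ≢i a j)))

  remove : Fin N → Vector Bool N → Vector Bool N
  remove j C i = not (does (i ≟ j)) ∧ C i

  insert : Fin N → Vector Bool N → Vector Bool N
  insert j C i = does (i ≟ j) ∨ C i

  remove-self : ∀ j (C : Vector Bool N) → remove j C j ≡ false
  remove-self j C = cong (λ b → not b ∧ C j) (dec-true (j ≟ j) refl)

  remove-other : ∀ {i j} (C : Vector Bool N) → i ≢ j → remove j C i ≡ C i
  remove-other {i = i} {j} C i≢j = cong (λ b → not b ∧ C i) (dec-false (i ≟ j) i≢j)

  insert-self : ∀ j (C : Vector Bool N) → insert j C j ≡ true
  insert-self j C = cong (_∨ C j) (dec-true (j ≟ j) refl)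

  insert-other : ∀ {i j} (C : Vector Bool N) → i ≢ j → insert j C i ≡ C i
  insert-other {i = i} {j} C i≢j = cong (_∨ C i) (dec-false (i ≟ j) i≢j)

  remove-comm : ∀ a b (C : Vector Bool N) → remove a (remove b C) ≗ remove b (remove a C)
  remove-comm a b C i with does (i ≟ a) | does (i ≟ b)
  ... | true  | true  = refl
  ... | true  | false = refl
  ... | false | _     = refl

  remove-insert : ∀ {j} {C : Vector Bool N} → C j ≡ false → remove j (insert j C) ≗ C
  remove-insert {j = j} {C} Cj≡false i with i ≟ j
  ... | yes refl = sym Cj≡false
  ... | no _     = refl

  remove-cong : ∀ j {C C′ : Vector Bool N} → C ≗ C′ → remove j C ≗ remove j C′
  remove-cong j C≗C′ i = cong (not (does (i ≟ j)) ∧_) (C≗C′ i)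

  count-insert : ∀ {j} {C : Vector Bool N} → C j ≡ false → count (insert j C) ≡ suc (count C)
  count-insert {j = j} {C} Cj≡false = trans (count-update j (λ i i≢j → sym (insert-other C i≢j)) Cj≡false)
                                            (cong (λ c → bit c ℕ.+ count C) (insert-self j C))

  below : Vector Bool N → Fin N → ℕ
  below C j = count (λ i → C i ∧ does (i <? j))

  below-cong : ∀ {C C′ : Vector Bool N} → C ≗ C′ → ∀ j → below C j ≡ below C′ j
  below-cong C≗C′ j = ℕΣ.sum-cong-≗ (λ i → cong (λ c → bit (c ∧ does (i <? j))) (C≗C′ i))

  below-remove : ∀ {a} (C : Vector Bool N) b → C a ≡ true → below C b ≡ bit (does (a <? b)) ℕ.+ below (remove a C) b
  below-remove {a = a} C b Ca≡true = trans
    (count-update a (λ i i≢a → cong (_∧ does (i <? b)) (remove-other C i≢a)) (cong (_∧ does (a <? b)) (remove-self a C)))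
    (cong (λ c → bit (c ∧ does (a <? b)) ℕ.+ below (remove a C) b) Ca≡true)

  sign : ℕ → ℤ
  sign k = -1ℤ ^ k

  sign-+ : ∀ m n → sign (m ℕ.+ n) ≡ sign m * sign n
  sign-+ = ℤ.^-distribˡ-+-* -1ℤ

  sign-square : ∀ k → sign k * sign k ≡ 1ℤ
  sign-square zero    = refl
  sign-square (suc k) = trans (ring (sign k)) (sign-square k)
    where
    ring : ∀ s → (-1ℤ * s) * (-1ℤ * s) ≡ s * s
    ring = solve-∀

  sign≢0 : ∀ k → sign k ≢ 0ℤ
  sign≢0 k sign≡0 with trans (sym (cong (λ s → s * s) sign≡0)) (sign-square k)
  ... | ()

  ∣sign∣ : ∀ k → ∣ sign k ∣ ≡ 1
  ∣sign∣ zero    = refl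
  ∣sign∣ (suc k) = trans (cong ∣_∣ (ℤ.-1*i≡-i (sign k))) (trans (ℤ.∣-i∣≡∣i∣ (sign k)) (∣sign∣ k))

  sign-flip : ∀ {a b : Fin N} → a ≢ b → sign (bit (does (b <? a))) ≡ - sign (bit (does (a <? b)))
  sign-flip {a = a} {b} a≢b with <-cmp a b
  ... | tri< a<b _ _ rewrite dec-true (a <? b) a<b | dec-false (b <? a) (<-asym a<b) = refl
  ... | tri≈ _ a≡b _ = ⊥-elim (a≢b a≡b)
  ... | tri> _ _ b<a rewrite dec-true (b <? a) b<a | dec-false (a <? b) (<-asym b<a) = refl

  -- The minor of the matrix with rows R on the columns C, by Laplace expansion along the first row;
  -- it is a genuine determinant only when length R ≡ count C.
  mutual
    det : List (Vector ℤ N) → Vector Bool N → ℤ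
    det []      C = 1ℤ
    det (r ∷ R) C = dot r (cofactor R C)

    cofactor : List (Vector ℤ N) → Vector Bool N → Vector ℤ N
    cofactor R C j = if C j then sign (below C j) * det R (remove j C) else 0ℤ

  mutual
    det-cong : ∀ (R : List (Vector ℤ N)) {C C′} → C ≗ C′ → det R C ≡ det R C′
    det-cong []      C≗C′ = refl
    det-cong (r ∷ R) C≗C′ = sum-cong-≗ (λ j → cong (r j *_) (cofactor-cong R C≗C′ j))

    cofactor-cong : ∀ (R : List (Vector ℤ N)) {C C′} → C ≗ C′ → cofactor R C ≗ cofactor R C′
    cofactor-cong R {C} {C′} C≗C′ j rewrite C≗C′ j with C′ j
    ... | true  = cong₂ _*_ (cong sign (below-cong C≗C′ j)) (det-cong R (remove-cong j C≗C′))
    ... | false = refl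

  cofactor-on : ∀ (R : List (Vector ℤ N)) {C j} → C j ≡ true → cofactor R C j ≡ sign (below C j) * det R (remove j C)
  cofactor-on R {C} {j} Cj≡true = cong (λ c → if c then sign (below C j) * det R (remove j C) else 0ℤ) Cj≡true

  cofactor-off : ∀ (R : List (Vector ℤ N)) {C j} → C j ≡ false → cofactor R C j ≡ 0ℤ
  cofactor-off R {C} {j} Cj≡false = cong (λ c → if c then sign (below C j) * det R (remove j C) else 0ℤ) Cj≡false

  cofactor-insert : ∀ (R : List (Vector ℤ N)) {C j} → C j ≡ false →
                    cofactor R (insert j C) j ≡ sign (below (insert j C) j) * det R C
  cofactor-insert R {C} {j} Cj≡false = trans (cofactor-on R (insert-self j C))
    (cong (sign (below (insert j C) j) *_) (det-cong R (remove-insert Cj≡false)))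

  -- The coefficient of r a * r′ b in det (r ∷ r′ ∷ R) C.
  coeff : List (Vector ℤ N) → Vector Bool N → Fin N → Fin N → ℤ
  coeff R C a b = if C a then sign (below C a) * cofactor R (remove a C) b else 0ℤ

  cofactor-∷ : ∀ r (R : List (Vector ℤ N)) C a → cofactor (r ∷ R) C a ≡ dot r (coeff R C a)
  cofactor-∷ r R C a with C a
  ... | true  = sym (dot-scaleʳ r (sign (below C a)) (cofactor R (remove a C)))
  ... | false = sym (dot-zeroʳ r (λ _ → refl))

  coeff-vanishes : ∀ (R : List (Vector ℤ N)) {C a b} → C a ∧ remove a C b ≡ false → coeff R C a b ≡ 0ℤ
  coeff-vanishes R {C} {a} {b} support≡false with C a
  ... | true  = trans (cong (sign (below C a) *_) (cofactor-off R support≡false)) (ℤ.*-zeroʳ (sign (below C a)))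
  ... | false = refl

  coeff-on : ∀ (R : List (Vector ℤ N)) {C a b} → C a ≡ true → remove a C b ≡ true →
             coeff R C a b ≡ sign (below C a) * (sign (below (remove a C) b) * det R (remove b (remove a C)))
  coeff-on R {C} {a} {b} Ca≡true Cb≡true = trans
    (cong (λ c → if c then sign (below C a) * cofactor R (remove a C) b else 0ℤ) Ca≡true)
    (cong (sign (below C a) *_) (cofactor-on R Cb≡true))

  signs-swap : ∀ (C : Vector Bool N) {a b} → a ≢ b → C a ≡ true → C b ≡ true →
               sign (below C a) * sign (below (remove a C) b) ≡ - (sign (below C b) * sign (below (remove b C) a))
  signs-swap C {a} {b} a≢b Ca≡true Cb≡true = begin
    sign (below C a) * sign Y                              ≡⟨ cong (λ k → sign k * sign Y) (below-remove C a Cb≡true) ⟩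
    sign (bit (does (b <? a)) ℕ.+ Y′) * sign Y             ≡⟨ cong (_* sign Y) (sign-+ (bit (does (b <? a))) Y′) ⟩
    sign (bit (does (b <? a))) * sign Y′ * sign Y          ≡⟨ cong (λ s → s * sign Y′ * sign Y) (sign-flip a≢b) ⟩
    - sign (bit (does (a <? b))) * sign Y′ * sign Y        ≡⟨ ring (sign (bit (does (a <? b)))) (sign Y) (sign Y′) ⟩
    - (sign (bit (does (a <? b))) * sign Y * sign Y′)      ≡⟨ cong (λ s → - (s * sign Y′)) (sign-+ (bit (does (a <? b))) Y) ⟨
    - (sign (bit (does (a <? b)) ℕ.+ Y) * sign Y′)         ≡⟨ cong (λ k → - (sign k * sign Y′)) (below-remove C b Ca≡true) ⟨
    - (sign (below C b) * sign Y′)                         ∎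
    where
    open ≡-Reasoning
    Y  = below (remove a C) b
    Y′ = below (remove b C) a
    ring : ∀ s y y′ → - s * y′ * y ≡ - (s * y * y′)
    ring = solve-∀

  coeff-antisym-distinct : ∀ (R : List (Vector ℤ N)) C {a b} → a ≢ b → coeff R C a b ≡ - coeff R C b a
  coeff-antisym-distinct R C {a} {b} a≢b = by-cases (C a) (C b) refl refl
    where
    open ≡-Reasoning
    d = det R (remove b (remove a C))
    ring : ∀ s y d → s * (y * d) ≡ s * y * d
    ring = solve-∀
    ring′ : ∀ s y d → - (s * y) * d ≡ - (s * (y * d))
    ring′ = solve-∀
    by-cases : ∀ ca cb → C a ≡ ca → C b ≡ cb → coeff R C a b ≡ - coeff R C b a
    by-cases false _ Ca Cb =
      trans (coeff-vanishes R (cong (_∧ remove a C b) Ca))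
            (sym (cong -_ (coeff-vanishes R (trans (cong (C b ∧_) (trans (remove-other C a≢b) Ca)) (∧-zeroʳ (C b))))))
    by-cases true false Ca Cb =
      trans (coeff-vanishes R (trans (cong (C a ∧_) (trans (remove-other C (a≢b ∘ sym)) Cb)) (∧-zeroʳ (C a))))
            (sym (cong -_ (coeff-vanishes R (cong (_∧ remove b C a) Cb))))
    by-cases true true Ca Cb = begin
      coeff R C a b                                             ≡⟨ coeff-on R Ca (trans (remove-other C (a≢b ∘ sym)) Cb) ⟩
      sign (below C a) * (sign (below (remove a C) b) * d)      ≡⟨ ring (sign (below C a)) (sign (below (remove a C) b)) d ⟩
      sign (below C a) * sign (below (remove a C) b) * d        ≡⟨ cong (_* d) (signs-swap C a≢b Ca Cb) ⟩
      - (sign (below C b) * sign (below (remove b C) a)) * d    ≡⟨ ring′ (sign (below C b)) (sign (below (remove b C) a)) d ⟩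
      - (sign (below C b) * (sign (below (remove b C) a) * d))  ≡⟨ cong (λ e → - (sign (below C b) * (sign (below (remove b C) a) * e)))
                                                                      (det-cong R (remove-comm b a C)) ⟩
      - (sign (below C b) * (sign (below (remove b C) a) * det R (remove a (remove b C))))
                                                                ≡⟨ cong -_ (coeff-on R Cb (trans (remove-other C a≢b) Ca)) ⟨
      - coeff R C b a                                           ∎

  coeff-antisym : ∀ (R : List (Vector ℤ N)) C a b → coeff R C a b ≡ - coeff R C b a
  coeff-antisym R C a b = by-decision (a ≟ b)
    where
    by-decision : Dec (a ≡ b) → coeff R C a b ≡ - coeff R C b a
    by-decision (no a≢b)  = coeff-antisym-distinct R C a≢b
    by-decision (yes refl) = trans diagonal (sym (cong -_ diagonal))
      where
      diagonal : coeff R C a a ≡ 0ℤ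
      diagonal = coeff-vanishes R (trans (cong (C a ∧_) (remove-self a C)) (∧-zeroʳ (C a)))

  det-swap : ∀ r r′ (R : List (Vector ℤ N)) C → det (r ∷ r′ ∷ R) C ≡ - det (r′ ∷ r ∷ R) C
  det-swap r r′ R C = begin
    dot r (cofactor (r′ ∷ R) C)            ≡⟨ sum-cong-≗ (λ a → cong (r a *_) (cofactor-∷ r′ R C a)) ⟩
    dot r (λ a → dot r′ (coeff R C a))      ≡⟨ dot-antisymmetric (coeff-antisym R C) r r′ ⟩
    - dot r′ (λ a → dot r (coeff R C a))    ≡⟨ cong -_ (sum-cong-≗ (λ a → cong (r′ a *_) (cofactor-∷ r R C a))) ⟨
    - dot r′ (cofactor (r ∷ R) C)          ∎
    where open ≡-Reasoning

  cofactor-zero : ∀ (R : List (Vector ℤ N)) → (∀ C → det R C ≡ 0ℤ) → ∀ C j → cofactor R C j ≡ 0ℤ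
  cofactor-zero R det≡0 C j with C j
  ... | true  = trans (cong (sign (below C j) *_) (det≡0 (remove j C))) (ℤ.*-zeroʳ (sign (below C j)))
  ... | false = refl

  det-repeated-row : ∀ {r} {R : List (Vector ℤ N)} → r ∈ R → ∀ C → det (r ∷ R) C ≡ 0ℤ
  det-repeated-row {r = r} {_ ∷ R}  (here refl) C = self-negating (det-swap r r R C)
  det-repeated-row {r = r} {r′ ∷ R} (there r∈R) C = trans (det-swap r r′ R C)
    (cong -_ (dot-zeroʳ r′ (cofactor-zero (r ∷ R) (det-repeated-row r∈R) C)))

  mutual
    ∣det∣≤ : ∀ {R : List (Vector ℤ N)} → All SignVector R → ∀ C → ∣ det R C ∣ ℕ.≤ N ℕ.^ length R
    ∣det∣≤ []                         C = ℕ.≤-refl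
    ∣det∣≤ {R = r ∷ R} (r-sign ∷ R-sign) C = ∣dot∣≤ r (cofactor R C) r-sign (∣cofactor∣≤ R-sign C)

    ∣cofactor∣≤ : ∀ {R : List (Vector ℤ N)} → All SignVector R → ∀ C j → ∣ cofactor R C j ∣ ℕ.≤ N ℕ.^ length R
    ∣cofactor∣≤ {N} {R} R-sign C j with C j
    ... | true  = begin
      ∣ sign (below C j) * det R (remove j C) ∣         ≡⟨ ℤ.∣i*j∣≡∣i∣*∣j∣ (sign (below C j)) (det R (remove j C)) ⟩
      ∣ sign (below C j) ∣ ℕ.* ∣ det R (remove j C) ∣   ≡⟨ cong (ℕ._* ∣ det R (remove j C) ∣) (∣sign∣ (below C j)) ⟩
      1 ℕ.* ∣ det R (remove j C) ∣                     ≡⟨ ℕ.*-identityˡ _ ⟩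
      ∣ det R (remove j C) ∣                           ≤⟨ ∣det∣≤ R-sign (remove j C) ⟩
      N ℕ.^ length R                                   ∎
      where open ℕ.≤-Reasoning
    ... | false = ℕ.z≤n

  _⊥_ : List (Vector ℤ N) → Vector ℤ N → Set
  R ⊥ y = ∀ {e} → e ∈ R → dot e y ≡ 0ℤ

  SupportedOn : Vector Bool N → Vector ℤ N → Set
  SupportedOn C y = ∀ i → C i ≡ false → y i ≡ 0ℤ

  KernelTrivial : List (Vector ℤ N) → Vector Bool N → Set
  KernelTrivial R C = ∀ {y} → R ⊥ y → SupportedOn C y → ∀ i → y i ≡ 0ℤ

  ⊥-combination : ∀ {R : List (Vector ℤ N)} {y z} p q → R ⊥ y → R ⊥ z → R ⊥ (λ i → p * y i + q * z i)
  ⊥-combination {y = y} {z} p q R⊥y R⊥z {e} e∈R = begin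
    dot e (λ i → p * y i + q * z i)  ≡⟨ dot-linearʳ e p y q z ⟩
    p * dot e y + q * dot e z        ≡⟨ cong₂ (λ u v → p * u + q * v) (R⊥y e∈R) (R⊥z e∈R) ⟩
    p * 0ℤ + q * 0ℤ                  ≡⟨ ring p q ⟩
    0ℤ                               ∎
    where
    open ≡-Reasoning
    ring : ∀ p q → p * 0ℤ + q * 0ℤ ≡ 0ℤ
    ring = solve-∀

  supported-combination : ∀ {C : Vector Bool N} {y z} p q → SupportedOn C y → SupportedOn C z →
                          SupportedOn C (λ i → p * y i + q * z i)
  supported-combination p q y-supported z-supported i Ci≡false =
    trans (cong₂ (λ u v → p * u + q * v) (y-supported i Ci≡false) (z-supported i Ci≡false)) (ring p q)
    where
    ring : ∀ p q → p * 0ℤ + q * 0ℤ ≡ 0ℤ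
    ring = solve-∀

  supported-insert⁻ : ∀ {C : Vector Bool N} {k y} → SupportedOn (insert k C) y → y k ≡ 0ℤ → SupportedOn C y
  supported-insert⁻ {C = C} {k} {y} y-supported yk≡0 i Ci≡false = by-decision (i ≟ k)
    where
    by-decision : Dec (i ≡ k) → y i ≡ 0ℤ
    by-decision (yes refl) = yk≡0
    by-decision (no i≢k)   = y-supported i (trans (insert-other C i≢k) Ci≡false)

  ⊥-scale : ∀ {R : List (Vector ℤ N)} {z} c → R ⊥ z → R ⊥ (λ i → c * z i)
  ⊥-scale {z = z} c R⊥z {e} e∈R = trans (dot-scaleʳ e c z) (trans (cong (c *_) (R⊥z e∈R)) (ℤ.*-zeroʳ c))

  supported-scale : ∀ {C : Vector Bool N} {z} c → SupportedOn C z → SupportedOn C (λ i → c * z i)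
  supported-scale c z-supported i Ci≡false = trans (cong (c *_) (z-supported i Ci≡false)) (ℤ.*-zeroʳ c)

  cofactor-⊥ : ∀ (R : List (Vector ℤ N)) C → R ⊥ cofactor R C
  cofactor-⊥ R C e∈R = det-repeated-row e∈R C

  cofactor-supported : ∀ (R : List (Vector ℤ N)) C → SupportedOn C (cofactor R C)
  cofactor-supported R C i = cofactor-off R

  -- Cramer's rule for a kernel vector y: with z = cofactor R (insert k C), the vector
  -- det R C · y − σ y_k · z is orthogonal to R and supported on C (its k-th entry cancels since z_k = σ det R C).
  kernel-collinear : ∀ {R : List (Vector ℤ N)} {C k} → KernelTrivial R C → C k ≡ false →
                     ∀ {y} → R ⊥ y → SupportedOn (insert k C) y →
                     ∀ i → det R C * y i ≡ sign (below (insert k C) k) * y k * cofactor R (insert k C) i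
  kernel-collinear {R = R} {C} {k} trivial Ck≡false {y} R⊥y y-supported i =
    ℤ.i-j≡0⇒i≡j _ _ (trans (ring D (y i) (σ * y k) (z i)) (trivial R⊥w w-supported i))
    where
    D = det R C
    σ = sign (below (insert k C) k)
    z = cofactor R (insert k C)
    w : Vector ℤ _
    w j = D * y j + (- (σ * y k)) * z j
    ring : ∀ d y s z → d * y - s * z ≡ d * y + (- s) * z
    ring = solve-∀
    R⊥w : R ⊥ w
    R⊥w = ⊥-combination D (- (σ * y k)) R⊥y (cofactor-⊥ R (insert k C))
    w-at-k : w k ≡ 0ℤ
    w-at-k = begin
      D * y k + (- (σ * y k)) * z k                ≡⟨ cong (λ v → D * y k + (- (σ * y k)) * v) (cofactor-insert R Ck≡false) ⟩
      D * y k + (- (σ * y k)) * (σ * D)            ≡⟨ ring′ D (y k) σ ⟩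
      D * y k * (1ℤ - σ * σ)                       ≡⟨ cong (λ v → D * y k * (1ℤ - v)) (sign-square (below (insert k C) k)) ⟩
      D * y k * (1ℤ - 1ℤ)                          ≡⟨ ℤ.*-zeroʳ (D * y k) ⟩
      0ℤ                                           ∎
      where
      open ≡-Reasoning
      ring′ : ∀ d y s → d * y + (- (s * y)) * (s * d) ≡ d * y * (1ℤ - s * s)
      ring′ = solve-∀
    w-supported : SupportedOn C w
    w-supported = supported-insert⁻ (supported-combination D (- (σ * y k)) y-supported (cofactor-supported R (insert k C)))
                                    w-at-k

  kernel-trivial-insert : ∀ {R : List (Vector ℤ N)} {C k} b → KernelTrivial R C → C k ≡ false → det R C ≢ 0ℤ →
                          det (b ∷ R) (insert k C) ≢ 0ℤ → KernelTrivial (b ∷ R) (insert k C)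
  kernel-trivial-insert {R = R} {C} {k} b trivial Ck≡false D≢0 D′≢0 {y} bR⊥y y-supported i =
    *≡0-cancelˡ D≢0 (trans (collinear i) (trans (cong (λ v → σ * v * z i) yk≡0) (ring σ (z i))))
    where
    D = det R C
    σ = sign (below (insert k C) k)
    z = cofactor R (insert k C)
    collinear : ∀ i → D * y i ≡ σ * y k * z i
    collinear = kernel-collinear trivial Ck≡false (bR⊥y ∘ there) y-supported
    σyk·D′≡0 : σ * y k * det (b ∷ R) (insert k C) ≡ 0ℤ
    σyk·D′≡0 = begin
      σ * y k * dot b z                ≡⟨ dot-scaleʳ b (σ * y k) z ⟨
      dot b (λ i → σ * y k * z i)      ≡⟨ dot-congʳ b collinear ⟨
      dot b (λ i → D * y i)            ≡⟨ dot-scaleʳ b D y ⟩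
      D * dot b y                      ≡⟨ cong (D *_) (bR⊥y (here refl)) ⟩
      D * 0ℤ                           ≡⟨ ℤ.*-zeroʳ D ⟩
      0ℤ                               ∎
      where open ≡-Reasoning
    yk≡0 : y k ≡ 0ℤ
    yk≡0 = *≡0-cancelˡ (sign≢0 (below (insert k C) k)) (*≡0-cancelʳ D′≢0 σyk·D′≡0)
    ring : ∀ s z → s * 0ℤ * z ≡ 0ℤ
    ring = solve-∀

  -- Cramer's generator of the kernel of R on the columns insert t C, scaled so that its t-th entry is (det R C)².
  ray : List (Vector ℤ N) → Vector Bool N → Fin N → Vector ℤ N
  ray R C t i = det R C * (sign (below (insert t C) t) * cofactor R (insert t C) i)

  ray-at : ∀ (R : List (Vector ℤ N)) {C t} → C t ≡ false → ray R C t t ≡ det R C * det R C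
  ray-at R {C} {t} Ct≡false = begin
    D * (σ * cofactor R (insert t C) t)  ≡⟨ cong (λ v → D * (σ * v)) (cofactor-insert R Ct≡false) ⟩
    D * (σ * (σ * D))                    ≡⟨ ring D σ ⟩
    D * (σ * σ) * D                      ≡⟨ cong (λ s → D * s * D) (sign-square (below (insert t C) t)) ⟩
    D * 1ℤ * D                           ≡⟨ cong (_* D) (ℤ.*-identityʳ D) ⟩
    D * D                                ∎
    where
    open ≡-Reasoning
    D = det R C
    σ = sign (below (insert t C) t)
    ring : ∀ d s → d * (s * (s * d)) ≡ d * (s * s) * d
    ring = solve-∀

  ray-collinear : ∀ {R : List (Vector ℤ N)} {C t} → KernelTrivial R C → C t ≡ false →
                  ∀ {x} → R ⊥ x → SupportedOn (insert t C) x → ∀ i → x t * ray R C t i ≡ det R C * det R C * x i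
  ray-collinear {R = R} {C} {t} trivial Ct≡false {x} R⊥x x-supported i = begin
    x t * (D * (σ * z i))   ≡⟨ ring (x t) D σ (z i) ⟩
    D * (σ * x t * z i)     ≡⟨ cong (D *_) (kernel-collinear trivial Ct≡false R⊥x x-supported i) ⟨
    D * (D * x i)           ≡⟨ ℤ.*-assoc D D (x i) ⟨
    D * D * x i             ∎
    where
    open ≡-Reasoning
    D = det R C
    k = below (insert t C) t
    σ = sign k
    z = cofactor R (insert t C)
    ring : ∀ x d s z → x * (d * (s * z)) ≡ d * (s * x * z)
    ring = solve-∀

  ∣ray∣≤ : ∀ {R : List (Vector ℤ N)} → All SignVector R →
           ∀ C t i → ∣ ray R C t i ∣ ℕ.≤ N ℕ.^ length R ℕ.* N ℕ.^ length R
  ∣ray∣≤ {N} {R} R-sign C t i = begin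
    ∣ D * (σ * z i) ∣              ≡⟨ ℤ.∣i*j∣≡∣i∣*∣j∣ D (σ * z i) ⟩
    ∣ D ∣ ℕ.* ∣ σ * z i ∣          ≡⟨ cong (∣ D ∣ ℕ.*_) (ℤ.∣i*j∣≡∣i∣*∣j∣ σ (z i)) ⟩
    ∣ D ∣ ℕ.* (∣ σ ∣ ℕ.* ∣ z i ∣)  ≡⟨ cong (λ s → ∣ D ∣ ℕ.* (s ℕ.* ∣ z i ∣)) (∣sign∣ k) ⟩
    ∣ D ∣ ℕ.* (1 ℕ.* ∣ z i ∣)      ≡⟨ cong (∣ D ∣ ℕ.*_) (ℕ.*-identityˡ ∣ z i ∣) ⟩
    ∣ D ∣ ℕ.* ∣ z i ∣              ≤⟨ ℕ.*-mono-≤ (∣det∣≤ R-sign C) (∣cofactor∣≤ R-sign (insert t C) i) ⟩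
    N ℕ.^ length R ℕ.* N ℕ.^ length R  ∎
    where
    open ℕ.≤-Reasoning
    D = det R C
    k = below (insert t C) t
    σ = sign k
    z = cofactor R (insert t C)

module Cones where

  open import Data.Nat as ℕ using (ℕ; zero; suc)
  import Data.Nat.Properties as ℕ
  open import Data.Integer as ℤ using (ℤ; -_; _+_; _-_; _*_; 0ℤ; ∣_∣; _≤_; _<_)
  import Data.Integer.Properties as ℤ
  open import Data.Integer.Tactic.RingSolver using (solve-∀)
  open import Data.Fin as Fin using (Fin; _≟_)
  open import Data.Fin.Properties using (any?; nonZeroIndex)
  open import Data.Bool as Bool using (Bool; true; false; not; _∨_)
  open import Data.Bool.Properties using (∨-zeroʳ)
  open import Data.Product using (Σ; _×_; _,_; proj₁; proj₂)
  open import Data.List using (List; []; _∷_; length)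
  open import Data.Vec.Functional using (Vector)
  open import Data.List.Membership.Propositional using (_∈_)
  open import Data.List.Relation.Unary.All as All using (All)
  open import Data.List.Relation.Unary.Any using (here; there)
  open import Data.Sum using (_⊎_; inj₁; inj₂)
  open import Data.Empty using (⊥-elim)
  open import Relation.Nullary using (does; yes; no; ¬_)
  open import Relation.Nullary.Decidable using (dec-true)
  open import Relation.Binary.PropositionalEquality
  open import Function using (_∘_)
  open IntegerVectors
  open Minors

  private variable N : ℕ

  module _ {A : Set} (s q : A → ℤ) where

    ratio-trans : ∀ {a b c} → 0ℤ < q a → 0ℤ < q b → 0ℤ < q c →
                  s a * q b ≤ s b * q a → s b * q c ≤ s c * q b → s a * q c ≤ s c * q a
    ratio-trans {a} {b} {c} qa>0 qb>0 qc>0 ab bc = ℤ.0≤i-j⇒j≤i (nonneg-cancelˡ qb>0 (subst (0ℤ ≤_) identity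
      (ℤ.+-mono-≤ (*-nonneg (ℤ.i≤j⇒0≤j-i ab) (ℤ.<⇒≤ qc>0)) (*-nonneg (ℤ.i≤j⇒0≤j-i bc) (ℤ.<⇒≤ qa>0)))))
      where
      ring : ∀ sa sb sc qa qb qc → (sb * qa - sa * qb) * qc + (sc * qb - sb * qc) * qa ≡ qb * (sc * qa - sa * qc)
      ring = solve-∀
      identity = ring (s a) (s b) (s c) (q a) (q b) (q c)

    record MinRatio (xs : List A) : Set where
      field
        argmin     : A
        argmin∈xs  : argmin ∈ xs
        argmin-pos : 0ℤ < q argmin
        minimal    : ∀ {a} → a ∈ xs → 0ℤ < q a → s argmin * q a ≤ s a * q argmin

    min-ratio : ∀ xs → MinRatio xs ⊎ (∀ {a} → a ∈ xs → ¬ 0ℤ < q a)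
    min-ratio []       = inj₂ (λ ())
    min-ratio (a ∷ xs) with min-ratio xs | 0ℤ ℤ.<? q a
    ... | inj₂ none | no  qa≯0 = inj₂ λ { (here refl) → qa≯0 ; (there a∈xs) → none a∈xs }
    ... | inj₂ none | yes qa>0 = inj₁ record
      { argmin = a ; argmin∈xs = here refl ; argmin-pos = qa>0
      ; minimal = λ { (here refl) _ → ℤ.≤-refl ; (there a′∈xs) qa′>0 → ⊥-elim (none a′∈xs qa′>0) } }
    ... | inj₁ m | no qa≯0 = inj₁ record
      { argmin = argmin ; argmin∈xs = there argmin∈xs ; argmin-pos = argmin-pos
      ; minimal = λ { (here refl) qa>0 → ⊥-elim (qa≯0 qa>0) ; (there a′∈xs) → minimal a′∈xs } }
      where open MinRatio m
    ... | inj₁ m | yes qa>0 with s a * q (MinRatio.argmin m) ℤ.≤? s (MinRatio.argmin m) * q a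
    ...   | yes a≤m = inj₁ record
      { argmin = a ; argmin∈xs = here refl ; argmin-pos = qa>0
      ; minimal = λ { (here refl) _ → ℤ.≤-refl
                    ; (there a′∈xs) qa′>0 → ratio-trans qa>0 argmin-pos qa′>0 a≤m (minimal a′∈xs qa′>0) } }
      where open MinRatio m
    ...   | no a≰m = inj₁ record
      { argmin = argmin ; argmin∈xs = there argmin∈xs ; argmin-pos = argmin-pos
      ; minimal = λ { (here refl) _ → ℤ.<⇒≤ (ℤ.≰⇒> a≰m) ; (there a′∈xs) → minimal a′∈xs } }
      where open MinRatio m

  module _ (L : List (Vector ℤ N)) where

    InCone : Vector ℤ N → Set
    InCone x = ∀ {a} → a ∈ L → 0ℤ ≤ dot a x

    InCone-rescale : ∀ {c d x u} → 0ℤ < c → 0ℤ ≤ d → (∀ i → c * u i ≡ d * x i) → InCone x → InCone u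
    InCone-rescale {c} {d} {x} {u} c>0 d≥0 cu≡dx x∈K {a} a∈L =
      nonneg-cancelˡ c>0 (subst (0ℤ ≤_) d·ax≡c·au (*-nonneg d≥0 (x∈K a∈L)))
      where
      d·ax≡c·au : d * dot a x ≡ c * dot a u
      d·ax≡c·au = trans (sym (dot-scaleʳ a d x)) (trans (dot-congʳ a (λ i → sym (cu≡dx i))) (dot-scaleʳ a c u))

    -- Walking from x in direction d, push x d b is (a positive multiple of) the point where the constraint b becomes tight.
    push : (x d b : Vector ℤ N) → Vector ℤ N
    push x d b i = (- dot b d) * x i + dot b x * d i

    dot-push : ∀ a x d b → dot a (push x d b) ≡ (- dot b d) * dot a x + dot b x * dot a d
    dot-push a x d b = dot-linearʳ a (- dot b d) x (dot b x) d

    push-tight : ∀ x d b → dot b (push x d b) ≡ 0ℤ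
    push-tight x d b = trans (dot-push b x d b) (ring (dot b d) (dot b x))
      where
      ring : ∀ q s → (- q) * s + s * q ≡ 0ℤ
      ring = solve-∀

    push-in-cone : ∀ {x d} → InCone x → (m : MinRatio (λ a → dot a x) (λ a → - dot a d) L) →
                   InCone (push x d (MinRatio.argmin m))
    push-in-cone {x} {d} x∈K m {a} a∈L with 0ℤ ℤ.<? - dot a d
    ... | yes qa>0 = subst (0ℤ ≤_) (trans (ring (dot a x) (dot b d) (dot b x) (dot a d)) (sym (dot-push a x d b)))
                       (ℤ.i≤j⇒0≤j-i (minimal a∈L qa>0))
      where
      open MinRatio m renaming (argmin to b)
      ring : ∀ sa qb sb qa → sa * (- qb) - sb * (- qa) ≡ (- qb) * sa + sb * qa
      ring = solve-∀
    ... | no qa≯0 = subst (0ℤ ≤_) (sym (dot-push a x d b))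
                      (ℤ.+-mono-≤ (*-nonneg (ℤ.<⇒≤ argmin-pos) (x∈K a∈L)) (*-nonneg (x∈K argmin∈xs) da≥0))
      where
      open MinRatio m renaming (argmin to b)
      da≥0 : 0ℤ ≤ dot a d
      da≥0 = subst (0ℤ ≤_) (ℤ.neg-involutive (dot a d)) (ℤ.neg-mono-≤ (ℤ.≮⇒≥ qa≯0))

    record Exit (x d : Vector ℤ N) : Set where
      field
        facet       : Vector ℤ N
        facet∈L     : facet ∈ L
        facet-d<0   : dot facet d < 0ℤ
        push∈K      : InCone (push x d facet)

    exit : ∀ {x d a} → InCone x → a ∈ L → dot a d < 0ℤ → Exit x d
    exit {x} {d} x∈K a∈L ad<0 with min-ratio (λ a → dot a x) (λ a → - dot a d) L
    ... | inj₂ none = ⊥-elim (none a∈L (ℤ.neg-mono-< ad<0))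
    ... | inj₁ m    = record
      { facet = argmin ; facet∈L = argmin∈xs
      ; facet-d<0 = subst (_< 0ℤ) (ℤ.neg-involutive (dot argmin d)) (ℤ.neg-mono-< argmin-pos)
      ; push∈K = push-in-cone x∈K m }
      where open MinRatio m

    push-outside : ∀ {x d} b {i} → d i ≡ 0ℤ → push x d b i ≡ (- dot b d) * x i
    push-outside {x} {d} b {i} di≡0 = trans (cong (λ v → (- dot b d) * x i + dot b x * v) di≡0) (ring (- dot b d) (x i) (dot b x))
      where
      ring : ∀ q x s → q * x + s * 0ℤ ≡ q * x
      ring = solve-∀

  module Pivoting (L : List (Vector ℤ N)) (unit∈L : ∀ m → unit m ∈ L) (t : Fin N) where

    free : Vector Bool N → Vector Bool N
    free C i = not (insert t C i)

    free⇒ : ∀ {C m} → free C m ≡ true → m ≢ t × C m ≡ false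
    free⇒ {C} {m} free-m = m≢t , proj₂ (not-∨ free-m)
      where
      not-∨ : ∀ {b c} → not (b ∨ c) ≡ true → b ≡ false × c ≡ false
      not-∨ {false} {false} refl = refl , refl
      m≢t : m ≢ t
      m≢t m≡t with trans (sym (dec-true (m ≟ t) m≡t)) (proj₁ (not-∨ free-m))
      ... | ()

    count-free-insert : ∀ {C m} → free C m ≡ true → count (free C) ≡ suc (count (free (insert m C)))
    count-free-insert {C} {m} free-m = trans
      (count-update m (λ i i≢m → cong (λ c → not (does (i ≟ t) ∨ c)) (insert-other C i≢m))
                      (trans (cong (λ c → not (does (m ≟ t) ∨ c)) (insert-self m C)) (cong not (∨-zeroʳ (does (m ≟ t))))))
      (cong (λ c → bit c ℕ.+ count (free (insert m C))) free-m)

    -- rows and cols form a nonsingular square minor of constraints tight at point; each step adds a row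
    -- and a column, until every column but t is used.
    record Pivot : Set where
      field
        rows           : List (Vector ℤ N)
        cols           : Vector Bool N
        point          : Vector ℤ N
        rows⊆L         : ∀ {e} → e ∈ rows → e ∈ L
        t∉cols         : cols t ≡ false
        square         : length rows ≡ count cols
        minor≢0        : det rows cols ≢ 0ℤ
        kernel-trivial : KernelTrivial rows cols
        point∈K        : InCone L point
        point-t>0      : 0ℤ < point t
        rows⊥point     : rows ⊥ point

    initial : ∀ {x} → InCone L x → 0ℤ < x t → Pivot
    initial {x} x∈K xt>0 = record
      { rows = [] ; cols = λ _ → false ; point = x
      ; rows⊆L = λ () ; t∉cols = refl ; square = sym (count-none {N}) ; minor≢0 = λ ()
      ; kernel-trivial = λ _ y-supported i → y-supported i refl
      ; point∈K = x∈K ; point-t>0 = xt>0 ; rows⊥point = λ () }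

    extend : (P : Pivot) → ∀ {m} → free (Pivot.cols P) m ≡ true → Σ Pivot (λ P′ → Pivot.cols P′ ≡ insert m (Pivot.cols P))
    extend P {m} free-m = P′ , refl
      where
      open Pivot P
      m≢t : m ≢ t
      m≢t = proj₁ (free⇒ {cols} free-m)
      m∉cols : cols m ≡ false
      m∉cols = proj₂ (free⇒ {cols} free-m)
      C′ = insert m cols
      z = cofactor rows C′
      zm≢0 : z m ≢ 0ℤ
      zm≢0 zm≡0 = minor≢0 (*≡0-cancelˡ (sign≢0 (below C′ m)) (trans (sym (cofactor-insert rows m∉cols)) zm≡0))
      -- z spans the kernel of rows on the columns C′; moving along d = −z_m z decreases coordinate m,
      -- so some constraint (at worst unit m) becomes tight.
      d : Vector ℤ _
      d i = - z m * z i
      d-at-m : dot (unit m) d < 0ℤ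
      d-at-m = subst (_< 0ℤ) (trans (ℤ.neg-distribˡ-* (z m) (z m)) (sym (dot-unitˡ m d))) (ℤ.neg-mono-< (square-pos zm≢0))
      E = exit L point∈K (unit∈L m) d-at-m
      open Exit E
      minor′≢0 : det (facet ∷ rows) C′ ≢ 0ℤ
      minor′≢0 bz≡0 = ℤ.<-irrefl (trans (dot-scaleʳ facet (- z m) z) (trans (cong (- z m *_) bz≡0) (ℤ.*-zeroʳ (- z m)))) facet-d<0
      t∉C′ : C′ t ≡ false
      t∉C′ = trans (insert-other cols (m≢t ∘ sym)) t∉cols
      d-supported : SupportedOn C′ d
      d-supported = supported-scale (- z m) (cofactor-supported rows C′)
      P′ : Pivot
      P′ = record
        { rows = facet ∷ rows ; cols = C′ ; point = push L point d facet
        ; rows⊆L = λ { (here refl) → facet∈L ; (there e∈rows) → rows⊆L e∈rows }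
        ; t∉cols = t∉C′
        ; square = trans (cong suc square) (sym (count-insert {C = cols} m∉cols))
        ; minor≢0 = minor′≢0
        ; kernel-trivial = kernel-trivial-insert facet kernel-trivial m∉cols minor≢0 minor′≢0
        ; point∈K = push∈K
        ; point-t>0 = subst (0ℤ <_) (sym (push-outside L facet (d-supported t t∉C′))) (*-pos (ℤ.neg-mono-< facet-d<0) point-t>0)
        ; rows⊥point = λ { (here refl) → push-tight L point d facet
                         ; (there e∈rows) → ⊥-combination (- dot facet d) (dot facet point) rows⊥point
                                                        (⊥-scale (- z m) (cofactor-⊥ rows C′)) e∈rows } }

    Complete : Pivot → Set
    Complete P = ∀ i → insert t (Pivot.cols P) i ≡ true

    pivot-all : ∀ k (P : Pivot) → count (free (Pivot.cols P)) ≡ k → Σ Pivot Complete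
    pivot-all k P count≡k with any? (λ i → free (Pivot.cols P) i Bool.≟ true)
    ... | no none = P , complete
      where
      complete : Complete P
      complete i with insert t (Pivot.cols P) i in eq
      ... | true  = refl
      ... | false = ⊥-elim (none (i , cong not eq))
    pivot-all zero    P count≡0 | yes (m , free-m) with trans (sym count≡0) (count-free-insert {Pivot.cols P} free-m)
    ... | ()
    pivot-all (suc k) P count≡k | yes (m , free-m) =
      pivot-all k (proj₁ extension) (ℕ.suc-injective (trans (sym count≡) count≡k))
      where
      extension = extend P free-m
      count≡ : count (free (Pivot.cols P)) ≡ suc (count (free (Pivot.cols (proj₁ extension))))
      count≡ = trans (count-free-insert {Pivot.cols P} free-m) (cong (λ C → suc (count (free C))) (sym (proj₂ extension)))

    complete⇒small-point : (∀ {a} → a ∈ L → SignVector a) → (P : Pivot) → Complete P →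
                           Σ (Vector ℤ N) λ u → InCone L u × 0ℤ < u t × (∀ i → ∣ u i ∣ ℕ.≤ N ℕ.^ N ℕ.* N ℕ.^ N)
    complete⇒small-point L-sign P complete = ray rows cols t , u∈K , ut>0 , ∣u∣≤
      where
      open Pivot P
      D²>0 : 0ℤ < det rows cols * det rows cols
      D²>0 = square-pos minor≢0
      point-supported : SupportedOn (insert t cols) point
      point-supported i outside with trans (sym (complete i)) outside
      ... | ()
      u∈K : InCone L (ray rows cols t)
      u∈K = InCone-rescale L point-t>0 (ℤ.<⇒≤ D²>0) (ray-collinear kernel-trivial t∉cols rows⊥point point-supported) point∈K
      ut>0 : 0ℤ < ray rows cols t t
      ut>0 = subst (0ℤ <_) (sym (ray-at rows t∉cols)) D²>0
      N^rows≤N^N : N ℕ.^ length rows ℕ.≤ N ℕ.^ N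
      N^rows≤N^N = ℕ.^-monoʳ-≤ N {{nonZeroIndex t}} (ℕ.≤-trans (ℕ.≤-reflexive square) (count-≤ cols))
      ∣u∣≤ : ∀ i → ∣ ray rows cols t i ∣ ℕ.≤ N ℕ.^ N ℕ.* N ℕ.^ N
      ∣u∣≤ i = ℕ.≤-trans (∣ray∣≤ (All.tabulate (λ e∈rows → L-sign (rows⊆L e∈rows))) cols t i)
                         (ℕ.*-mono-≤ N^rows≤N^N N^rows≤N^N)

    small-point : (∀ {a} → a ∈ L → SignVector a) → ∀ {x} → InCone L x → 0ℤ < x t →
                  Σ (Vector ℤ N) λ u → InCone L u × 0ℤ < u t × (∀ i → ∣ u i ∣ ℕ.≤ N ℕ.^ N ℕ.* N ℕ.^ N)
    small-point L-sign x∈K xt>0 = complete⇒small-point L-sign (proj₁ pivoted) (proj₂ pivoted)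
      where
      pivoted = pivot-all _ (initial x∈K xt>0) refl

module Thresholds where

  open import Data.Nat using (ℕ; zero; suc; _+_; _*_; _^_; _≤_; _<_; _≤?_; z≤n; s≤s)
  open import Data.Nat.Properties using (≤-refl; ≤-trans; ≰⇒>; <⇒≱; m≤n+m)
  open import Data.Integer as ℤ using (ℤ; +_; -_; 0ℤ; 1ℤ; -1ℤ; ∣_∣; +≤+; +<+)
  import Data.Integer.Properties as ℤ
  open import Data.Integer.Tactic.RingSolver using (solve-∀)
  open import Data.Fin using (Fin; zero; suc)
  open import Data.Bool using (true; false; if_then_else_)
  open import Data.List using (List; [_]; map; _++_; allFin)
  open import Data.List.Membership.Propositional using (_∈_)
  open import Data.List.Membership.Propositional.Properties using (∈-map⁺; ∈-map⁻; ∈-++⁺ˡ; ∈-++⁺ʳ; ∈-++⁻; ∈-allFin)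
  open import Data.List.Relation.Unary.Any using (here)
  open import Data.Product using (Σ; ∃; _×_; _,_; proj₁; proj₂)
  open import Data.Sum using (_⊎_; inj₁; inj₂)
  open import Data.Vec.Functional as Vector using (Vector; _∷_)
  open import Function using (_∘_)
  open import Relation.Nullary using (yes; no; ¬_)
  open import Data.Empty using (⊥-elim)
  open import Relation.Binary.PropositionalEquality hiding ([_])
  open IntegerVectors
  open Cones

  private variable n : ℕ

  ∑-cong : ∀ {f g : Fin n → ℕ} → f ≗ g → ∑ n f ≡ ∑ n g
  ∑-cong {zero}  f≗g = refl
  ∑-cong {suc n} f≗g = cong₂ _+_ (f≗g zero) (∑-cong (f≗g ∘ suc))

  ∑∈-cong : ∀ {S S′ : ItemSet n} f → S ≗ S′ → ∑∈ S f ≡ ∑∈ S′ f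
  ∑∈-cong f S≗S′ = ∑-cong (λ i → cong (λ b → if b then f i else 0) (S≗S′ i))

  subsets : (n : ℕ) → List (ItemSet n)
  subsets zero    = [ Vector.[] ]
  subsets (suc n) = map (true ∷_) (subsets n) ++ map (false ∷_) (subsets n)

  ∷-∈-subsets : ∀ b {S : ItemSet n} → S ∈ subsets n → (b ∷ S) ∈ subsets (suc n)
  ∷-∈-subsets true  S∈ = ∈-++⁺ˡ (∈-map⁺ (true ∷_) S∈)
  ∷-∈-subsets false S∈ = ∈-++⁺ʳ (map (true ∷_) (subsets _)) (∈-map⁺ (false ∷_) S∈)

  subsets-complete : ∀ (S : ItemSet n) → ∃ λ S′ → S′ ∈ subsets n × S ≗ S′
  subsets-complete {zero}  S = Vector.[] , here refl , λ ()
  subsets-complete {suc n} S with subsets-complete (S ∘ suc)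
  ... | S′ , S′∈ , S≗S′ = S zero ∷ S′ , ∷-∈-subsets (S zero) S′∈ , λ { zero → refl ; (suc i) → S≗S′ i }

  dot-indicator : ∀ (S : ItemSet n) f → dot (indicator S) (+_ ∘ f) ≡ + ∑∈ S f
  dot-indicator {zero}  S f = refl
  dot-indicator {suc n} S f = cong₂ ℤ._+_ (head (S zero)) (dot-indicator (S ∘ suc) (f ∘ suc))
    where
    head : ∀ b → (if b then 1ℤ else 0ℤ) ℤ.* + f zero ≡ + (if b then f zero else 0)
    head true  = ℤ.*-identityˡ (+ f zero)
    head false = refl

  -- Coordinates of Vector ℤ (2 + n): the slack ε, the capacity, then the weights of the n items.
  encode : ℤ → ℕ → (Fin n → ℕ) → Vector ℤ (2 + n)
  encode ε b w = ε ∷ + b ∷ (+_ ∘ w)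

  fitRow : ItemSet n → Vector ℤ (2 + n)
  fitRow S = 0ℤ ∷ 1ℤ ∷ (λ i → - indicator S i)

  overRow : ItemSet n → Vector ℤ (2 + n)
  overRow S = -1ℤ ∷ -1ℤ ∷ indicator S

  dot-fitRow : ∀ (S : ItemSet n) ε β ω → dot (fitRow S) (ε ∷ β ∷ ω) ≡ β ℤ.- dot (indicator S) ω
  dot-fitRow S ε β ω = trans (cong (λ s → 0ℤ ℤ.* ε ℤ.+ (1ℤ ℤ.* β ℤ.+ s)) (dot-negˡ (indicator S) ω))
                             (ring ε β (dot (indicator S) ω))
    where
    ring : ∀ e b s → 0ℤ ℤ.* e ℤ.+ (1ℤ ℤ.* b ℤ.+ - s) ≡ b ℤ.- s
    ring = solve-∀

  dot-overRow : ∀ (S : ItemSet n) ε β ω → dot (overRow S) (ε ∷ β ∷ ω) ≡ dot (indicator S) ω ℤ.- (ε ℤ.+ β)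
  dot-overRow S ε β ω = ring ε β (dot (indicator S) ω)
    where
    ring : ∀ e b s → -1ℤ ℤ.* e ℤ.+ (-1ℤ ℤ.* b ℤ.+ s) ≡ s ℤ.- (e ℤ.+ b)
    ring = solve-∀

  row : (Fin n → ℕ) → ℕ → ItemSet n → Vector ℤ (2 + n)
  row w b S with ∑∈ S w ≤? b
  ... | yes _ = fitRow S
  ... | no  _ = overRow S

  row-sign : ∀ (w : Fin n → ℕ) b S → SignVector (row w b S)
  row-sign w b S with ∑∈ S w ≤? b
  ... | yes _ = λ { zero → z≤n ; (suc zero) → ≤-refl
                  ; (suc (suc i)) → subst (_≤ 1) (sym (ℤ.∣-i∣≡∣i∣ (indicator S i))) (indicator-sign S i) }
  ... | no  _ = λ { zero → ≤-refl ; (suc zero) → ≤-refl ; (suc (suc i)) → indicator-sign S i }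

  row-encode : ∀ (w : Fin n → ℕ) b S → 0ℤ ℤ.≤ dot (row w b S) (encode 1ℤ b w)
  row-encode w b S with ∑∈ S w ≤? b
  ... | yes fits = subst (0ℤ ℤ.≤_) (sym (trans (dot-fitRow S 1ℤ (+ b) (+_ ∘ w)) (cong (λ s → + b ℤ.- s) (dot-indicator S w))))
                     (ℤ.i≤j⇒0≤j-i (+≤+ fits))
  ... | no  over = subst (0ℤ ℤ.≤_) (sym (trans (dot-overRow S 1ℤ (+ b) (+_ ∘ w)) (cong (ℤ._- + suc b) (dot-indicator S w))))
                     (ℤ.i≤j⇒0≤j-i (+≤+ (≰⇒> over)))

  SameFeasible : (Fin n → ℕ) → ℕ → (Fin n → ℕ) → ℕ → ItemSet n → Set
  SameFeasible w b w′ b′ S = (∑∈ S w ≤ b → ∑∈ S w′ ≤ b′) × (∑∈ S w′ ≤ b′ → ∑∈ S w ≤ b)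

  row-sound : ∀ (w : Fin n → ℕ) b S {ε b′ w′} → 0ℤ ℤ.< ε → 0ℤ ℤ.≤ dot (row w b S) (encode ε b′ w′) →
              SameFeasible w b w′ b′ S
  row-sound w b S {ε} {b′} {w′} ε>0 holds with ∑∈ S w ≤? b
  ... | yes fits = (λ _ → ℤ.drop‿+≤+ (ℤ.0≤i-j⇒j≤i (subst (0ℤ ℤ.≤_) slack≡ holds))) , (λ _ → fits)
    where
    slack≡ : dot (fitRow S) (encode ε b′ w′) ≡ + b′ ℤ.- + ∑∈ S w′
    slack≡ = trans (dot-fitRow S ε (+ b′) (+_ ∘ w′)) (cong (λ s → + b′ ℤ.- s) (dot-indicator S w′))
  ... | no  over = (λ fits → ⊥-elim (over fits))
                 , (λ fits′ → ⊥-elim (exceeds ε>0 (ℤ.0≤i-j⇒j≤i (subst (0ℤ ℤ.≤_) slack≡ holds)) fits′))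
    where
    slack≡ : dot (overRow S) (encode ε b′ w′) ≡ + ∑∈ S w′ ℤ.- (ε ℤ.+ + b′)
    slack≡ = trans (dot-overRow S ε (+ b′) (+_ ∘ w′)) (cong (ℤ._- (ε ℤ.+ + b′)) (dot-indicator S w′))
    exceeds : ∀ {ε b′ s} → 0ℤ ℤ.< ε → ε ℤ.+ + b′ ℤ.≤ + s → ¬ s ≤ b′
    exceeds {ℤ.+[1+ k ]} {b′} _        (+≤+ k+b′<s) = <⇒≱ (≤-trans (s≤s (m≤n+m b′ k)) k+b′<s)
    exceeds {+ zero}             (+<+ ()) _

  SameFeasible-cong : ∀ {w b w′ b′} {S S′ : ItemSet n} → S ≗ S′ → SameFeasible w b w′ b′ S′ → SameFeasible w b w′ b′ S
  SameFeasible-cong {w = w} {w′ = w′} S≗S′ rewrite ∑∈-cong w S≗S′ | ∑∈-cong w′ S≗S′ = λ same → same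

  constraints : (Fin n → ℕ) → ℕ → List (Vector ℤ (2 + n))
  constraints {n} w b = map (row w b) (subsets n) ++ map unit (allFin (2 + n))

  constraints⁻ : ∀ {w : Fin n → ℕ} {b a} → a ∈ constraints w b → (∃ λ S → a ≡ row w b S) ⊎ (∃ λ m → a ≡ unit m)
  constraints⁻ {n} {w} {b} a∈ with ∈-++⁻ (map (row w b) (subsets n)) a∈
  ... | inj₁ a∈rows  = inj₁ (proj₁ (∈-map⁻ (row w b) a∈rows) , proj₂ (proj₂ (∈-map⁻ (row w b) a∈rows)))
  ... | inj₂ a∈units = inj₂ (proj₁ (∈-map⁻ unit a∈units) , proj₂ (proj₂ (∈-map⁻ unit a∈units)))

  unit∈constraints : ∀ (w : Fin n → ℕ) b m → unit m ∈ constraints w b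
  unit∈constraints {n} w b m = ∈-++⁺ʳ (map (row w b) (subsets n)) (∈-map⁺ unit (∈-allFin m))

  row∈constraints : ∀ (w : Fin n → ℕ) b {S} → S ∈ subsets n → row w b S ∈ constraints w b
  row∈constraints w b S∈ = ∈-++⁺ˡ (∈-map⁺ (row w b) S∈)

  constraints-sign : ∀ {w : Fin n → ℕ} {b a} → a ∈ constraints w b → SignVector a
  constraints-sign {w = w} {b} a∈ with constraints⁻ a∈
  ... | inj₁ (S , refl) = row-sign w b S
  ... | inj₂ (m , refl) = unit-sign m

  encode∈constraints : ∀ (w : Fin n → ℕ) b → InCone (constraints w b) (encode 1ℤ b w)
  encode∈constraints w b a∈ with constraints⁻ a∈
  ... | inj₁ (S , refl) = row-encode w b S
  ... | inj₂ (m , refl) = subst (0ℤ ℤ.≤_) (sym (dot-unitˡ m (encode 1ℤ b w))) (encode≥0 m)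
    where
    encode≥0 : ∀ m → 0ℤ ℤ.≤ encode 1ℤ b w m
    encode≥0 zero          = +≤+ z≤n
    encode≥0 (suc zero)    = +≤+ z≤n
    encode≥0 (suc (suc i)) = +≤+ z≤n

  constraints-sound : ∀ (w : Fin n → ℕ) b {u} → InCone (constraints w b) u → 0ℤ ℤ.< u zero →
                      ∀ S → SameFeasible w b (λ i → ∣ u (suc (suc i)) ∣) ∣ u (suc zero) ∣ S
  constraints-sound w b {u} u∈K u₀>0 S with subsets-complete S
  ... | S′ , S′∈ , S≗S′ = SameFeasible-cong S≗S′
    (row-sound w b S′ u₀>0 (subst (0ℤ ℤ.≤_) (dot-congʳ (row w b S′) u≗encode) (u∈K (row∈constraints w b S′∈))))
    where
    u≥0 : ∀ m → 0ℤ ℤ.≤ u m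
    u≥0 m = subst (0ℤ ℤ.≤_) (dot-unitˡ m u) (u∈K (unit∈constraints w b m))
    u≗encode : u ≗ encode (u zero) ∣ u (suc zero) ∣ (λ i → ∣ u (suc (suc i)) ∣)
    u≗encode zero          = refl
    u≗encode (suc zero)    = sym (ℤ.0≤i⇒+∣i∣≡i (u≥0 (suc zero)))
    u≗encode (suc (suc i)) = sym (ℤ.0≤i⇒+∣i∣≡i (u≥0 (suc (suc i))))

  weightBound : ℕ → ℕ
  weightBound n = (2 + n) ^ (2 + n) * (2 + n) ^ (2 + n)

  record CapacityReduction (w : Fin n → ℕ) (b : ℕ) : Set where
    field
      weight′    : Fin n → ℕ
      capacity′  : ℕ
      weight′≤   : ∀ i → weight′ i ≤ weightBound n
      capacity′≤ : capacity′ ≤ weightBound n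
      same       : ∀ S → SameFeasible w b weight′ capacity′ S

  capacity-reduction : ∀ (w : Fin n → ℕ) b → CapacityReduction w b
  capacity-reduction {n} w b = decode (Pivoting.small-point (constraints w b) (unit∈constraints w b) zero
                                         constraints-sign {encode 1ℤ b w} (encode∈constraints w b) (+<+ (s≤s z≤n)))
    where
    decode : (∃ λ u → InCone (constraints w b) u × 0ℤ ℤ.< u zero × (∀ i → ∣ u i ∣ ≤ weightBound n)) → CapacityReduction w b
    decode (u , u∈K , u₀>0 , ∣u∣≤) = record
      { weight′ = λ i → ∣ u (suc (suc i)) ∣ ; capacity′ = ∣ u (suc zero) ∣
      ; weight′≤ = λ i → ∣u∣≤ (suc (suc i)) ; capacity′≤ = ∣u∣≤ (suc zero)
      ; same = constraints-sound w b {u} u∈K u₀>0 }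

  record TargetReduction (p : Fin n → ℕ) (T : ℕ) : Set where
    field
      profit′  : Fin n → ℕ
      target′  : ℕ
      profit′≤ : ∀ i → profit′ i ≤ weightBound n
      target′≤ : target′ ≤ suc (weightBound n)
      same     : ∀ S → (T ≤ ∑∈ S p → target′ ≤ ∑∈ S profit′) × (target′ ≤ ∑∈ S profit′ → T ≤ ∑∈ S p)

  -- T + 1 ≤ Σ p fails exactly when the capacity constraint Σ p ≤ T holds.
  target-reduction : ∀ (p : Fin n → ℕ) T → TargetReduction p T
  target-reduction p zero    = record
    { profit′ = λ _ → 0 ; target′ = 0 ; profit′≤ = λ _ → z≤n ; target′≤ = z≤n
    ; same = λ S → (λ _ → z≤n) , (λ _ → z≤n) }
  target-reduction p (suc T) = record
    { profit′ = weight′ ; target′ = suc capacity′ ; profit′≤ = weight′≤ ; target′≤ = s≤s capacity′≤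
    ; same = λ S → (λ T<Σ → ≰⇒> (λ Σ′≤b′ → <⇒≱ T<Σ (proj₂ (same S) Σ′≤b′)))
                 , (λ b′<Σ′ → ≰⇒> (λ Σ≤T → <⇒≱ b′<Σ′ (proj₁ (same S) Σ≤T))) }
    where open CapacityReduction (capacity-reduction p T)

-- ℕ arithmetic is opened only below the integer developments, whose operators have the same names.
open import Data.Nat
open import Data.Nat.Properties
open import Data.Nat.Induction using (<-rec)
open import Data.Nat.Logarithm
  using (⌊log₂_⌋; ⌈log₂_⌉; ⌊log₂⌋-mono-≤; ⌊log₂[2^n]⌋≡n; ⌈log₂⌉-mono-≤; ⌈log₂2^n⌉≡n; ⌈log₂⌈n/2⌉⌉≡⌈log₂n⌉∸1)
open import Data.Nat.Tactic.RingSolver using (solve-∀)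
open import Data.Fin using (Fin; zero; suc)
open import Data.Product using (Σ; _×_; _,_; proj₁; proj₂)
open import Function using (_∘_)
open import Relation.Binary.PropositionalEquality
open Thresholds

n≤2^⌈log₂n⌉ : ∀ n → n ≤ 2 ^ ⌈log₂ n ⌉
n≤2^⌈log₂n⌉ = <-rec (λ n → n ≤ 2 ^ ⌈log₂ n ⌉) step
  where
  step : ∀ n → (∀ {m} → m < n → m ≤ 2 ^ ⌈log₂ m ⌉) → n ≤ 2 ^ ⌈log₂ n ⌉
  step zero          _   = z≤n
  step (suc zero)    _   = s≤s z≤n
  step n@(suc (suc k)) rec = begin
    n                               ≡⟨ ⌊n/2⌋+⌈n/2⌉≡n n ⟨
    ⌊ n /2⌋ + ⌈ n /2⌉               ≤⟨ +-monoˡ-≤ ⌈ n /2⌉ (⌊n/2⌋≤⌈n/2⌉ n) ⟩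
    ⌈ n /2⌉ + ⌈ n /2⌉               ≤⟨ +-mono-≤ half≤ half≤ ⟩
    2 ^ (L ∸ 1) + 2 ^ (L ∸ 1)       ≡⟨ cong (2 ^ (L ∸ 1) +_) (+-identityʳ _) ⟨
    2 ^ suc (L ∸ 1)                 ≡⟨ cong (2 ^_) (trans (+-comm 1 (L ∸ 1)) (m∸n+n≡m 1≤L)) ⟩
    2 ^ L                           ∎
    where
    open ≤-Reasoning
    L = ⌈log₂ n ⌉
    1≤L : 1 ≤ L
    1≤L = subst (_≤ L) (⌈log₂2^n⌉≡n 1) (⌈log₂⌉-mono-≤ {2} {n} (s≤s (s≤s z≤n)))
    half≤ : ⌈ n /2⌉ ≤ 2 ^ (L ∸ 1)
    half≤ = subst (λ e → ⌈ n /2⌉ ≤ 2 ^ e) (⌈log₂⌈n/2⌉⌉≡⌈log₂n⌉∸1 n) (rec (⌈n/2⌉<n k))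

bitLength-mono : ∀ {u v} → u ≤ v → bitLength u ≤ bitLength v
bitLength-mono {zero}  {zero}  _       = ≤-refl
bitLength-mono {zero}  {suc v} _       = s≤s z≤n
bitLength-mono {suc u} {suc v} su≤sv   = s≤s (⌊log₂⌋-mono-≤ su≤sv)

bitLength-≤ : ∀ {v} E → v ≤ 2 ^ E → bitLength v ≤ suc E
bitLength-≤ {zero}  E _     = s≤s z≤n
bitLength-≤ {suc v} E v≤2^E = s≤s (subst (⌊log₂ suc v ⌋ ≤_) (⌊log₂[2^n]⌋≡n E) (⌊log₂⌋-mono-≤ v≤2^E))

-- (2 + n) ≤ 2 ^ (2L) with L = ⌈log₂ n⌉, so weightBound n ≤ 2 ^ (4L(2 + n)).
bitLength-weightBound : ∀ {n} → 2 ≤ n → bitLength (suc (weightBound n)) ≤ 9 * (n * ⌈log₂ n ⌉)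
bitLength-weightBound {n} 2≤n = begin
  bitLength (suc (weightBound n))    ≤⟨ bitLength-≤ (suc E) (≤-trans (s≤s bound≤2^E) 1+2^E≤2^[1+E]) ⟩
  suc (suc E)                        ≡⟨ expand n L ⟩
  2 + 4 * (n * L) + 4 * (2 * L)      ≤⟨ +-mono-≤ (+-monoˡ-≤ (4 * (n * L)) 2≤nL) (*-monoʳ-≤ 4 (*-monoˡ-≤ L 2≤n)) ⟩
  n * L + 4 * (n * L) + 4 * (n * L)  ≡⟨ collect (n * L) ⟩
  9 * (n * L)                        ∎
  where
  open ≤-Reasoning
  L = ⌈log₂ n ⌉
  K = 2 + n
  G = L + L
  E = G * K + G * K
  1≤L : 1 ≤ L
  1≤L = subst (_≤ L) (⌈log₂2^n⌉≡n 1) (⌈log₂⌉-mono-≤ 2≤n)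
  2≤nL : 2 ≤ n * L
  2≤nL = subst (_≤ n * L) (*-identityʳ 2) (*-mono-≤ 2≤n 1≤L)
  K≤2^G : K ≤ 2 ^ G
  K≤2^G = begin
    2 + n          ≤⟨ +-monoˡ-≤ n 2≤n ⟩
    n + n          ≤⟨ +-mono-≤ (n≤2^⌈log₂n⌉ n) (n≤2^⌈log₂n⌉ n) ⟩
    2 ^ L + 2 ^ L  ≡⟨ cong (2 ^ L +_) (+-identityʳ _) ⟨
    2 ^ suc L      ≤⟨ ^-monoʳ-≤ 2 (subst (_≤ G) (+-comm L 1) (+-monoʳ-≤ L 1≤L)) ⟩
    2 ^ G          ∎
  bound≤2^E : weightBound n ≤ 2 ^ E
  bound≤2^E = begin
    K ^ K * K ^ K              ≤⟨ *-mono-≤ (^-monoˡ-≤ K K≤2^G) (^-monoˡ-≤ K K≤2^G) ⟩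
    (2 ^ G) ^ K * (2 ^ G) ^ K  ≡⟨ cong₂ _*_ (^-*-assoc 2 G K) (^-*-assoc 2 G K) ⟩
    2 ^ (G * K) * 2 ^ (G * K)  ≡⟨ ^-distribˡ-+-* 2 (G * K) (G * K) ⟨
    2 ^ E                      ∎
  1+2^E≤2^[1+E] : suc (2 ^ E) ≤ 2 ^ suc E
  1+2^E≤2^[1+E] = subst (suc (2 ^ E) ≤_) (cong (2 ^ E +_) (sym (+-identityʳ _))) (+-monoˡ-≤ (2 ^ E) (m^n>0 2 E))
  expand : ∀ n L → suc (suc ((L + L) * (2 + n) + (L + L) * (2 + n))) ≡ 2 + 4 * (n * L) + 4 * (2 * L)
  expand = solve-∀
  collect : ∀ x → x + 4 * x + 4 * x ≡ 9 * x
  collect = solve-∀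

∑-≤ : ∀ {m} (f : Fin m → ℕ) {c} → (∀ i → f i ≤ c) → ∑ m f ≤ m * c
∑-≤ {zero}  f f≤c = z≤n
∑-≤ {suc m} f f≤c = +-mono-≤ (f≤c zero) (∑-≤ (f ∘ suc) (f≤c ∘ suc))

NumbersAtMost : ∀ {n M} → MKInstance n M → ℕ → Set
NumbersAtMost J B = (∀ i j → weight J i j ≤ B) × (∀ i → profit J i ≤ B) × (∀ j → capacity J j ≤ B) × target J ≤ B

size-≤ : ∀ {n M} (J : MKInstance n M) {B} → NumbersAtMost J B → size J ≤ (n * M + n + M + 1) * bitLength B
size-≤ {n} {M} J {B} (weight≤ , profit≤ , capacity≤ , target≤) = begin
  size J                               ≤⟨ +-mono-≤ (+-mono-≤ (+-mono-≤
                                            (∑-≤ _ (λ i → ∑-≤ _ (λ j → bitLength-mono (weight≤ i j))))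
                                            (∑-≤ _ (λ i → bitLength-mono (profit≤ i))))
                                            (∑-≤ _ (λ j → bitLength-mono (capacity≤ j))))
                                            (bitLength-mono target≤) ⟩
  n * (M * β) + n * β + M * β + β       ≡⟨ collect n M β ⟩
  (n * M + n + M + 1) * β               ∎
  where
  open ≤-Reasoning
  β = bitLength B
  collect : ∀ n M β → n * (M * β) + n * β + M * β + β ≡ (n * M + n + M + 1) * β
  collect = solve-∀

module _ {n M} (I : MKInstance n M) where

  capacityReduction : (j : Fin M) → CapacityReduction (λ i → weight I i j) (capacity I j)
  capacityReduction j = capacity-reduction (λ i → weight I i j) (capacity I j)

  targetReduction : TargetReduction (profit I) (target I)
  targetReduction = target-reduction (profit I) (target I)

  reduced : MKInstance n M
  reduced = record
    { weight   = λ i j → CapacityReduction.weight′ (capacityReduction j) i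
    ; profit   = TargetReduction.profit′ targetReduction
    ; capacity = λ j → CapacityReduction.capacity′ (capacityReduction j)
    ; target   = TargetReduction.target′ targetReduction }

  reduced-equivalent : StaticEquivalent I reduced
  reduced-equivalent S =
    (λ (fits , profitable) → (λ j → proj₁ (CapacityReduction.same (capacityReduction j) S) (fits j))
                           , proj₁ (TargetReduction.same targetReduction S) profitable) ,
    (λ (fits , profitable) → (λ j → proj₂ (CapacityReduction.same (capacityReduction j) S) (fits j))
                           , proj₂ (TargetReduction.same targetReduction S) profitable)

  reduced-numbers : NumbersAtMost reduced (suc (weightBound n))
  reduced-numbers =
    (λ i j → m≤n⇒m≤1+n (CapacityReduction.weight′≤ (capacityReduction j) i)) ,
    (λ i → m≤n⇒m≤1+n (TargetReduction.profit′≤ targetReduction i)) ,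
    (λ j → m≤n⇒m≤1+n (CapacityReduction.capacity′≤ (capacityReduction j))) ,
    TargetReduction.target′≤ targetReduction

numbers-count-≤ : ∀ {n M} → 1 ≤ n → 1 ≤ M → n * M + n + M + 1 ≤ 4 * (n * M)
numbers-count-≤ {n} {M} 1≤n 1≤M = begin
  n * M + n + M + 1              ≤⟨ +-mono-≤ (+-mono-≤ (+-monoʳ-≤ (n * M) n≤nM) M≤nM) 1≤nM ⟩
  n * M + n * M + n * M + n * M  ≡⟨ collect (n * M) ⟩
  4 * (n * M)                    ∎
  where
  open ≤-Reasoning
  n≤nM : n ≤ n * M
  n≤nM = subst (_≤ n * M) (*-identityʳ n) (*-monoʳ-≤ n 1≤M)
  M≤nM : M ≤ n * M
  M≤nM = subst (_≤ n * M) (*-identityˡ M) (*-monoˡ-≤ M 1≤n)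
  1≤nM : 1 ≤ n * M
  1≤nM = *-mono-≤ 1≤n 1≤M
  collect : ∀ x → x + x + x + x ≡ 4 * x
  collect = solve-∀

corollary5 : Σ ℕ (λ C → (n M : ℕ) → 2 ≤ n → 1 ≤ M → (I : MKInstance n M) →
               Σ (MKInstance n M) (λ J →
                 StaticEquivalent I J × (size J ≤ C * M * (n * n) * ⌈log₂ n ⌉)))
corollary5 = 36 , λ n M 2≤n 1≤M I → reduced I , reduced-equivalent I , (begin
  size (reduced I)                                         ≤⟨ size-≤ (reduced I) (reduced-numbers I) ⟩
  (n * M + n + M + 1) * bitLength (suc (weightBound n))    ≤⟨ *-mono-≤ (numbers-count-≤ (≤-trans (s≤s z≤n) 2≤n) 1≤M)
                                                                        (bitLength-weightBound 2≤n) ⟩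
  4 * (n * M) * (9 * (n * ⌈log₂ n ⌉))                      ≡⟨ collect n M ⌈log₂ n ⌉ ⟩
  36 * M * (n * n) * ⌈log₂ n ⌉                             ∎)
  where
  open ≤-Reasoning
  collect : ∀ n M L → 4 * (n * M) * (9 * (n * L)) ≡ 36 * M * (n * n) * L
  collect = solve-∀
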